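{- Let $P=(X,\leq)$ be a finite interval order and let $\lambda$ be an admissible labelling of $P$. If $x,y,z\in X$ satisfy $x<y$ in $P$ and $\lambda(y)\leq\lambda(z)$, then $x<z$ in $P$.
   Context: A finite poset $P=(X,\leq)$ is an interval order if there is a map assigning to each $x\in X$ a closed real interval $[a_x,b_x]$ such that $x<y$ in $P$ iff $b_x<a_y$ (equivalently, $P$ contains no induced subposet isomorphic to $2+2$, the disjoint union of two 2-element chains). For $x\in X$ let $I(x)=\{z: z<x\}$ and $F(x)=\{z : z>x\}$ (strict). Write $x\sim y$ if $I(x)=I(y)$ and $F(x)=F(y)$. A linear extension of $P$ is a bijection $\lambda:X\to\{1,\dots,|X|\}$ with $x<y\Rightarrow\lambda(x)<\lambda(y)$. A linear extension $\lambda$ is an admissible labelling if for all $x,y\in X$ with $\lambda(x)<\lambda(y)$, either $I(x)\subset I(y)$, or ($I(x)=I(y)$ and $F(x)\subset F(y)$), or $x\sim y$. -}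

module Defs where

open import Data.Nat using (ℕ)
open import Data.Fin using (Fin) renaming (_<_ to _<ᶠ_)
open import Data.Product using (_×_; ∃-syntax; _,_)
open import Data.Sum using (_⊎_)
open import Relation.Nullary using (¬_)
open import Relation.Binary.PropositionalEquality using (_≡_; _≢_)
open import Relation.Binary.Structures using (IsPartialOrder)
open import Function.Definitions using (Bijective)

record FinPoset (n : ℕ) : Set₁ where
  field
    _≤_       : Fin n → Fin n → Set
    isPartialOrder : IsPartialOrder _≡_ _≤_

  _<_ : Fin n → Fin n → Set
  x < y = (x ≤ y) × (x ≢ y)

  _∥_ : Fin n → Fin n → Set
  x ∥ y = ¬ (x ≤ y) × ¬ (y ≤ x)

module _ {n : ℕ} (P : FinPoset n) where
  open FinPoset P

  -- interval order: no induced subposet isomorphic to 2+2,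
  -- Explicitly: no four elements a<b, c<d with a,b each incomparable to c,d.
  IsIntervalOrder : Set
  IsIntervalOrder = ∀ a b c d → a < b → c < d →
    ¬ ((a ∥ c) × (a ∥ d) × (b ∥ c) × (b ∥ d))

  -- Sets as predicates: I(x) = {z : z < x}, F(x) = {z : x < z}
  Down : Fin n → Fin n → Set
  Down x z = z < x

  Up : Fin n → Fin n → Set
  Up x z = x < z

  _⊆_ : (Fin n → Set) → (Fin n → Set) → Set
  A ⊆ B = ∀ z → A z → B z

  _⊂_ : (Fin n → Set) → (Fin n → Set) → Set
  A ⊂ B = (A ⊆ B) × (∃[ z ] (B z × ¬ A z))

  _≐_ : (Fin n → Set) → (Fin n → Set) → Set
  A ≐ B = (A ⊆ B) × (B ⊆ A)

  _∼_ : Fin n → Fin n → Set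
  x ∼ y = (Down x ≐ Down y) × (Up x ≐ Up y)

  -- linear extension: bijection λ : X → {1..|X|} (here Fin n, 0-based) that is
  -- strictly order preserving.
  IsLinearExtension : (Fin n → Fin n) → Set
  IsLinearExtension lam = Bijective _≡_ _≡_ lam × (∀ x y → x < y → lam x <ᶠ lam y)

  IsAdmissibleLabelling : (Fin n → Fin n) → Set
  IsAdmissibleLabelling lam = IsLinearExtension lam ×
    (∀ x y → lam x <ᶠ lam y →
       (Down x ⊂ Down y)
       ⊎ ((Down x ≐ Down y) × (Up x ⊂ Up y))
       ⊎ (x ∼ y))

-- Each of the three alternatives in the definition of an admissible labelling
-- gives I(y) ⊆ I(z) whenever λ(y) < λ(z); injectivity of λ extends this to
-- λ(y) ≤ λ(z), and x < y says x ∈ I(y).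
module Submission where

open import Defs
open import Data.Nat using (ℕ)
open import Data.Fin using (Fin; _≤_; _<_)
open import Data.Fin.Properties using (toℕ-injective)
open import Data.Nat.Properties using (m≤n⇒m<n∨m≡n)
open import Data.Product using (_,_; proj₁; proj₂)
open import Data.Sum using (inj₁; inj₂)
open import Relation.Binary.PropositionalEquality using (_≡_; subst)

module _ {n : ℕ} (P : FinPoset n) {lam : Fin n → Fin n}
         (admissible : IsAdmissibleLabelling P lam) where

  admissible⇒Down-monotone< : ∀ y z → lam y < lam z →
    _⊆_ P (Down P y) (Down P z)
  admissible⇒Down-monotone< y z ly<lz with proj₂ admissible y z ly<lz
  ... | inj₁ (Iy⊆Iz , _)              = Iy⊆Iz
  ... | inj₂ (inj₁ ((Iy⊆Iz , _) , _)) = Iy⊆Iz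
  ... | inj₂ (inj₂ ((Iy⊆Iz , _) , _)) = Iy⊆Iz

  admissible⇒Down-monotone : ∀ y z → lam y ≤ lam z →
    _⊆_ P (Down P y) (Down P z)
  admissible⇒Down-monotone y z ly≤lz with m≤n⇒m<n∨m≡n ly≤lz
  ... | inj₁ ly<lz = admissible⇒Down-monotone< y z ly<lz
  ... | inj₂ ly≡lz = subst (λ w → _⊆_ P (Down P y) (Down P w))
                           (lam-injective (toℕ-injective ly≡lz)) (λ _ x<y → x<y)
    where
    lam-injective : ∀ {a b} → lam a ≡ lam b → a ≡ b
    lam-injective = proj₁ (proj₁ (proj₁ admissible))

mainTheorem2 : ∀ {n : ℕ} (P : FinPoset n) → IsIntervalOrder P →
    (lam : Fin n → Fin n) → IsAdmissibleLabelling P lam →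
    ∀ x y z → FinPoset._<_ P x y → lam y ≤ lam z → FinPoset._<_ P x z
mainTheorem2 P _ lam admissible x y z x<y ly≤lz =
  admissible⇒Down-monotone P admissible y z ly≤lz x x<y
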